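{- Let $P$ be any integral polytope in $\mathbb{R}^n$ and $\pi:\mathbb{R}^n\to\mathbb{R}^m$ any integral linear map that is injective on the vertices of $P$. If $\pi(P)$ is integrally indecomposable, then so is $P$.
   Context: An integral polytope is a convex polytope whose vertices have integer coordinates. An integral polytope is integrally decomposable if it is the Minkowski sum $A+B=\{a+b:a\in A,b\in B\}$ of two integral polytopes $A,B$ each with more than one point, and integrally indecomposable otherwise. A linear map $\pi:\mathbb{R}^n\to\mathbb{R}^m$ is integral if it maps points of $\mathbb{Z}^n$ to points of $\mathbb{Z}^m$.
   Formalization: Polytopes are taken as sets of points of ℚ^n and ℚ^m rather than $\mathbb{R}^n$ and $\mathbb{R}^m$, so vertices, Minkowski sums and the image $\pi(P)$ are computed on rational points. -}

module Defs where

open import Data.Nat using (ℕ; zero; suc)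
open import Data.Integer using (ℤ)
open import Data.Fin using (Fin; zero; suc)
open import Data.Rational using (ℚ; _/_; 0ℚ; 1ℚ; _+_; _*_; _-_; _≤_; _<_)
open import Data.Product using (Σ; ∃; _×_; _,_)
open import Relation.Binary.PropositionalEquality using (_≡_)
open import Relation.Nullary using (¬_)

-- Points of ℚ^n (rational points of ℝ^n), as functions Fin n → ℚ.
Pt : ℕ → Set
Pt n = Fin n → ℚ

_≈_ : ∀ {n} → Pt n → Pt n → Set
x ≈ y = ∀ i → x i ≡ y i

embed : ∀ {n} → (Fin n → ℤ) → Pt n
embed z i = z i / 1

sumFin : ∀ {k} → (Fin k → ℚ) → ℚ
sumFin {zero}  f = 0ℚ
sumFin {suc k} f = f zero + sumFin (λ i → f (suc i))

_⊕_ : ∀ {n} → Pt n → Pt n → Pt n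
(x ⊕ y) i = x i + y i

_·_ : ∀ {n} → ℚ → Pt n → Pt n
(t · x) i = t * x i

PtSet : ℕ → Set₁
PtSet n = Pt n → Set

-- An integral polytope: the convex hull of a nonempty finite list of lattice points.
record IntPolytope (n : ℕ) : Set where
  constructor intPolytope
  field
    k     : ℕ
    verts : Fin (suc k) → Fin n → ℤ

⟦_⟧ : ∀ {n} → IntPolytope n → PtSet n
⟦ intPolytope k V ⟧ x =
  Σ (Fin (suc k) → ℚ) λ λs →
    (∀ j → 0ℚ ≤ λs j) × (sumFin λs ≡ 1ℚ) ×
    (∀ i → x i ≡ sumFin (λ j → λs j * (V j i / 1)))

MoreThanOnePoint : ∀ {n} → PtSet n → Set
MoreThanOnePoint S = Σ _ λ x → Σ _ λ y → S x × S y × ¬ (x ≈ y)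

Minkowski : ∀ {n} → PtSet n → PtSet n → PtSet n
Minkowski A B x = Σ _ λ a → Σ _ λ b → A a × B b × (x ≈ (a ⊕ b))

SameSet : ∀ {n} → PtSet n → PtSet n → Set
SameSet S T = ∀ x → (S x → T x) × (T x → S x)

IntDecomposable : ∀ {n} → PtSet n → Set
IntDecomposable {n} S =
  Σ (IntPolytope n) λ A → Σ (IntPolytope n) λ B →
    MoreThanOnePoint ⟦ A ⟧ × MoreThanOnePoint ⟦ B ⟧ ×
    SameSet S (Minkowski ⟦ A ⟧ ⟦ B ⟧)

IntIndecomposable : ∀ {n} → PtSet n → Set
IntIndecomposable S = ¬ IntDecomposable S

IsVertex : ∀ {n} → PtSet n → Pt n → Set
IsVertex S v = S v × (∀ x y t → S x → S y → 0ℚ < t → t < 1ℚ →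
                       v ≈ ((t · x) ⊕ ((1ℚ - t) · y)) → x ≈ y)

LinMap : ℕ → ℕ → Set
LinMap m n = Fin m → Fin n → ℚ

apply : ∀ {m n} → LinMap m n → Pt n → Pt m
apply π x i = sumFin (λ j → π i j * x j)

IsIntegral : ∀ {m n} → LinMap m n → Set
IsIntegral {m} {n} π = ∀ (z : Fin n → ℤ) → Σ (Fin m → ℤ) λ w → apply π (embed z) ≈ embed w

image : ∀ {m n} → LinMap m n → PtSet n → PtSet m
image π S y = Σ _ λ x → S x × (y ≈ apply π x)

InjectiveOnVertices : ∀ {m n} → LinMap m n → PtSet n → Set
InjectiveOnVertices π S =
  ∀ u v → IsVertex S u → IsVertex S v → apply π u ≈ apply π v → u ≈ v

-- If P = A + B, then π(P) = π(A) + π(B), where π(A) and π(B) are the integral polytopes spanned by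
-- the images of the generators, so it suffices that π(A) (and likewise π(B)) is not a point.
-- Suppose π is constant on A, and let b be the point of B maximising π lexicographically. Then the
-- points of P maximising π lexicographically form the face A + b. Its lexicographically largest and
-- smallest points in the coordinates are vertices of P with the same image under π, hence equal, so
-- A is a single point.
module Submission where

open import Algebra.Bundles using (CommutativeMonoid)
import Algebra.Properties.CommutativeSemigroup as CommSemigroupProperties
open import Data.Empty using (⊥-elim)
open import Data.Fin using (Fin; zero; suc)
open import Data.Fin.Properties using (all?; ¬∀⟶∃¬)
open import Data.List using (List; []; _∷_; _++_; map; tabulate; filter; allFin)
open import Data.List.Membership.Propositional using (_∈_)
open import Data.List.Membership.Propositional.Properties using (∈-filter⁺; ∈-filter⁻; ∈-allFin)
open import Data.List.Relation.Unary.All as All using (All; []; _∷_)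
open import Data.List.Relation.Unary.All.Properties using (++⁻ʳ; map⁻; tabulate⁺; tabulate⁻)
open import Data.List.Relation.Unary.Any using (here; there)
open import Data.Nat using (ℕ; zero; suc)
open import Data.Product using (∃-syntax; _×_; _,_; proj₁; proj₂)
open import Data.Rational using (ℚ; 0ℚ; 1ℚ; _+_; _*_; _-_; -_; _≤_; _<_; positive; nonNegative)
import Data.Rational.Properties as ℚ
open import Data.Rational.Solver using (module +-*-Solver)
open import Data.Sum using (_⊎_; inj₁; inj₂)
open import Data.Unit using (⊤; tt)
import Data.Vec.Functional as Vector
open import Relation.Binary.Bundles using (DecTotalOrder)
open import Relation.Binary.PropositionalEquality
  using (_≡_; refl; sym; trans; cong; cong₂; subst; subst₂; module ≡-Reasoning)
open import Relation.Nullary using (Dec; yes; no)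
open import Relation.Unary using (Decidable)

open import Data.List.Extrema (DecTotalOrder.totalOrder ℚ.≤-decTotalOrder)
  using (argmax; argmax-sel; f[⊥]≤f[argmax]; f[xs]≤f[argmax])
open CommSemigroupProperties (CommutativeMonoid.commutativeSemigroup ℚ.+-0-commutativeMonoid)
  using () renaming (interchange to +-interchange)
open CommSemigroupProperties (CommutativeMonoid.commutativeSemigroup ℚ.*-1-commutativeMonoid)
  using () renaming (x∙yz≈y∙xz to *-swapˡ)
open import Algebra.Properties.Group ℚ.+-0-group
  using () renaming (⁻¹-involutive to neg-involutive; ∙-cancelʳ to +-cancelʳ)
open +-*-Solver using (solve; _:=_; _:+_; _:-_; con)

open import Defs

sumFin-cong : ∀ {k} {f g : Fin k → ℚ} → (∀ j → f j ≡ g j) → sumFin f ≡ sumFin g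
sumFin-cong {zero}  _   = refl
sumFin-cong {suc k} f≗g = cong₂ _+_ (f≗g zero) (sumFin-cong (λ j → f≗g (suc j)))

sumFin-distrib-+ : ∀ {k} (f g : Fin k → ℚ) → sumFin (λ j → f j + g j) ≡ sumFin f + sumFin g
sumFin-distrib-+ {zero}  f g = refl
sumFin-distrib-+ {suc k} f g =
  trans (cong (f zero + g zero +_) (sumFin-distrib-+ (λ j → f (suc j)) (λ j → g (suc j))))
        (+-interchange (f zero) (g zero) _ _)

*-distribˡ-sumFin : ∀ {k} c (f : Fin k → ℚ) → c * sumFin f ≡ sumFin (λ j → c * f j)
*-distribˡ-sumFin {zero}  c f = ℚ.*-zeroʳ c
*-distribˡ-sumFin {suc k} c f =
  trans (ℚ.*-distribˡ-+ c (f zero) _) (cong (c * f zero +_) (*-distribˡ-sumFin c (λ j → f (suc j))))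

*-distribʳ-sumFin : ∀ {k} c (f : Fin k → ℚ) → sumFin f * c ≡ sumFin (λ j → f j * c)
*-distribʳ-sumFin c f =
  trans (ℚ.*-comm (sumFin f) c) (trans (*-distribˡ-sumFin c f) (sumFin-cong (λ j → ℚ.*-comm c (f j))))

neg-distrib-sumFin : ∀ {k} (f : Fin k → ℚ) → - sumFin f ≡ sumFin (λ j → - f j)
neg-distrib-sumFin {zero}  f = refl
neg-distrib-sumFin {suc k} f =
  trans (ℚ.neg-distrib-+ (f zero) _) (cong (- f zero +_) (neg-distrib-sumFin (λ j → f (suc j))))

sumFin-zero : ∀ k → sumFin {k} (λ _ → 0ℚ) ≡ 0ℚ
sumFin-zero zero    = refl
sumFin-zero (suc k) = cong (0ℚ +_) (sumFin-zero k)

sumFin-comm : ∀ {k l} (F : Fin k → Fin l → ℚ) →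
  sumFin (λ i → sumFin (F i)) ≡ sumFin (λ j → sumFin (λ i → F i j))
sumFin-comm {zero}  {l} F = sym (sumFin-zero l)
sumFin-comm {suc k}     F =
  trans (cong (sumFin (F zero) +_) (sumFin-comm (λ i → F (suc i))))
        (sym (sumFin-distrib-+ (F zero) (λ j → sumFin (λ i → F (suc i) j))))

sumFin-mono-≤ : ∀ {k} {f g : Fin k → ℚ} → (∀ j → f j ≤ g j) → sumFin f ≤ sumFin g
sumFin-mono-≤ {zero}  _   = ℚ.≤-refl
sumFin-mono-≤ {suc k} f≤g = ℚ.+-mono-≤ (f≤g zero) (sumFin-mono-≤ (λ j → f≤g (suc j)))

sumFin-mono-< : ∀ {k} {f g : Fin k → ℚ} → (∀ j → f j ≤ g j) → ∀ j → f j < g j → sumFin f < sumFin g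
sumFin-mono-< f≤g zero    f<g = ℚ.+-mono-<-≤ f<g (sumFin-mono-≤ (λ j → f≤g (suc j)))
sumFin-mono-< f≤g (suc j) f<g = ℚ.+-mono-≤-< (f≤g zero) (sumFin-mono-< (λ j → f≤g (suc j)) j f<g)

basis : ∀ {k} → Fin k → Fin k → ℚ
basis zero    zero    = 1ℚ
basis zero    (suc _) = 0ℚ
basis (suc _) zero    = 0ℚ
basis (suc i) (suc j) = basis i j

basis-nonNeg : ∀ {k} (i j : Fin k) → 0ℚ ≤ basis i j
basis-nonNeg zero    zero    = ℚ.nonNegative⁻¹ 1ℚ
basis-nonNeg zero    (suc j) = ℚ.≤-refl
basis-nonNeg (suc i) zero    = ℚ.≤-refl
basis-nonNeg (suc i) (suc j) = basis-nonNeg i j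

sumFin-basis : ∀ {k} (i : Fin k) (f : Fin k → ℚ) → sumFin (λ j → basis i j * f j) ≡ f i
sumFin-basis {suc k} zero f = begin
  1ℚ * f zero + sumFin (λ j → 0ℚ * f (suc j)) ≡⟨ cong₂ _+_ (ℚ.*-identityˡ (f zero))
                                                           (sumFin-cong (λ j → ℚ.*-zeroˡ (f (suc j)))) ⟩
  f zero + sumFin {k} (λ _ → 0ℚ)              ≡⟨ cong (f zero +_) (sumFin-zero k) ⟩
  f zero + 0ℚ                                 ≡⟨ ℚ.+-identityʳ (f zero) ⟩
  f zero                                      ∎
  where open ≡-Reasoning
sumFin-basis {suc k} (suc i) f =
  trans (cong₂ _+_ (ℚ.*-zeroˡ (f zero)) (sumFin-basis i (λ j → f (suc j)))) (ℚ.+-identityˡ (f (suc i)))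

sumFin[basis]≡1 : ∀ {k} (i : Fin k) → sumFin (basis i) ≡ 1ℚ
sumFin[basis]≡1 i =
  trans (sumFin-cong (λ j → sym (ℚ.*-identityʳ (basis i j)))) (sumFin-basis i (λ _ → 1ℚ))

*-monoˡ-≤-support : ∀ {w a b} → 0ℚ ≤ w → (0ℚ < w → a ≤ b) → w * a ≤ w * b
*-monoˡ-≤-support {w} {a} {b} w≥0 a≤b with 0ℚ ℚ.<? w
... | yes w>0 = ℚ.*-monoˡ-≤-nonNeg w {{nonNegative w≥0}} (a≤b w>0)
... | no  w≯0 rewrite ℚ.≤-antisym (ℚ.≮⇒≥ w≯0) w≥0 =
  ℚ.≤-reflexive (trans (ℚ.*-zeroˡ a) (sym (ℚ.*-zeroˡ b)))

module _ {k : ℕ} {w : Fin k → ℚ} (w≥0 : ∀ j → 0ℚ ≤ w j) (∑w≡1 : sumFin w ≡ 1ℚ) where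

  average-const : ∀ m → sumFin (λ j → w j * m) ≡ m
  average-const m = begin
    sumFin (λ j → w j * m) ≡⟨ *-distribʳ-sumFin m w ⟨
    sumFin w * m           ≡⟨ cong (_* m) ∑w≡1 ⟩
    1ℚ * m                 ≡⟨ ℚ.*-identityˡ m ⟩
    m                      ∎
    where open ≡-Reasoning

  module _ {h : Fin k → ℚ} {m : ℚ} (h≤m : ∀ j → 0ℚ < w j → h j ≤ m) where

    average-≤ : sumFin (λ j → w j * h j) ≤ m
    average-≤ = subst (_ ≤_) (average-const m) (sumFin-mono-≤ (λ j → *-monoˡ-≤-support (w≥0 j) (h≤m j)))

    average-≡⇒≡ : sumFin (λ j → w j * h j) ≡ m → ∀ j → 0ℚ < w j → h j ≡ m
    average-≡⇒≡ average≡m j wj>0 with h j ℚ.<? m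
    ... | no  hj≮m = ℚ.≤-antisym (h≤m j wj>0) (ℚ.≮⇒≥ hj≮m)
    ... | yes hj<m = ⊥-elim (ℚ.<-irrefl average≡m (subst (_ <_) (average-const m) average<m))
      where
      average<m : sumFin (λ j → w j * h j) < sumFin (λ j → w j * m)
      average<m = sumFin-mono-< (λ j → *-monoˡ-≤-support (w≥0 j) (h≤m j)) j
                    (ℚ.*-monoʳ-<-pos (w j) {{positive wj>0}} hj<m)

convex-≡⇒≡ : ∀ {t a b c} → 0ℚ < t → t < 1ℚ → a ≤ c → b ≤ c → t * a + (1ℚ - t) * b ≡ c → a ≡ c × b ≡ c
convex-≡⇒≡ {t} {a} {b} {c} t>0 t<1 a≤c b≤c combination≡c =
  extreme zero t>0 , extreme (suc zero) 1-t>0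
  where
  w h : Fin 2 → ℚ
  w = t Vector.∷ (1ℚ - t) Vector.∷ Vector.[]
  h = a Vector.∷ b Vector.∷ Vector.[]
  1-t>0 : 0ℚ < 1ℚ - t
  1-t>0 = subst (_< 1ℚ - t) (ℚ.+-inverseʳ t) (ℚ.+-monoˡ-< (- t) t<1)
  w≥0 : ∀ j → 0ℚ ≤ w j
  w≥0 zero       = ℚ.<⇒≤ t>0
  w≥0 (suc zero) = ℚ.<⇒≤ 1-t>0
  ∑w≡1 : sumFin w ≡ 1ℚ
  ∑w≡1 = solve 1 (λ t → t :+ ((con 1ℚ :- t) :+ con 0ℚ) := con 1ℚ) refl t
  h≤c : ∀ j → 0ℚ < w j → h j ≤ c
  h≤c zero       _ = a≤c
  h≤c (suc zero) _ = b≤c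
  extreme : ∀ j → 0ℚ < w j → h j ≡ c
  extreme = average-≡⇒≡ w≥0 ∑w≡1 h≤c (trans (cong (t * a +_) (ℚ.+-identityʳ _)) combination≡c)

⟨_,_⟩ : ∀ {n} → Pt n → Pt n → ℚ
⟨ c , x ⟩ = sumFin (λ i → c i * x i)

comb : ∀ {n k} → (Fin k → ℚ) → (Fin k → Pt n) → Pt n
comb w X i = sumFin (λ j → w j * X j i)

negate : ∀ {n} → Pt n → Pt n
negate c i = - c i

module _ {n : ℕ} (c : Pt n) where

  ⟨⟩-congʳ : ∀ {x y} → x ≈ y → ⟨ c , x ⟩ ≡ ⟨ c , y ⟩
  ⟨⟩-congʳ x≈y = sumFin-cong (λ i → cong (c i *_) (x≈y i))

  ⟨⟩-distrib-⊕ : ∀ x y → ⟨ c , x ⊕ y ⟩ ≡ ⟨ c , x ⟩ + ⟨ c , y ⟩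
  ⟨⟩-distrib-⊕ x y =
    trans (sumFin-cong (λ i → ℚ.*-distribˡ-+ (c i) (x i) (y i)))
          (sumFin-distrib-+ (λ i → c i * x i) (λ i → c i * y i))

  ⟨⟩-· : ∀ t x → ⟨ c , t · x ⟩ ≡ t * ⟨ c , x ⟩
  ⟨⟩-· t x =
    trans (sumFin-cong (λ i → *-swapˡ (c i) t (x i))) (sym (*-distribˡ-sumFin t (λ i → c i * x i)))

  ⟨⟩-comb : ∀ {k} (w : Fin k → ℚ) (X : Fin k → Pt n) →
            ⟨ c , comb w X ⟩ ≡ sumFin (λ j → w j * ⟨ c , X j ⟩)
  ⟨⟩-comb w X = begin
    sumFin (λ i → c i * sumFin (λ j → w j * X j i))
      ≡⟨ sumFin-cong (λ i → *-distribˡ-sumFin (c i) (λ j → w j * X j i)) ⟩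
    sumFin (λ i → sumFin (λ j → c i * (w j * X j i)))
      ≡⟨ sumFin-comm (λ i j → c i * (w j * X j i)) ⟩
    sumFin (λ j → sumFin (λ i → c i * (w j * X j i)))
      ≡⟨ sumFin-cong (λ j → sumFin-cong (λ i → *-swapˡ (c i) (w j) (X j i))) ⟩
    sumFin (λ j → sumFin (λ i → w j * (c i * X j i)))
      ≡⟨ sumFin-cong (λ j → *-distribˡ-sumFin (w j) (λ i → c i * X j i)) ⟨
    sumFin (λ j → w j * ⟨ c , X j ⟩)
      ∎
    where open ≡-Reasoning

  ⟨negate⟩ : ∀ x → ⟨ negate c , x ⟩ ≡ - ⟨ c , x ⟩
  ⟨negate⟩ x = trans (sumFin-cong (λ i → sym (ℚ.neg-distribˡ-* (c i) (x i))))
                     (sym (neg-distrib-sumFin (λ i → c i * x i)))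

  ⟨negate⟩-injective : ∀ {x y} → ⟨ negate c , x ⟩ ≡ ⟨ negate c , y ⟩ → ⟨ c , x ⟩ ≡ ⟨ c , y ⟩
  ⟨negate⟩-injective {x} {y} e = ℚ.neg-injective (trans (sym (⟨negate⟩ x)) (trans e (⟨negate⟩ y)))

infix 4 _≤[_]_ _≡[_]_

_≤[_]_ : ∀ {n} → Pt n → List (Pt n) → Pt n → Set
x ≤[ []     ] y = ⊤
x ≤[ c ∷ cs ] y = ⟨ c , x ⟩ < ⟨ c , y ⟩ ⊎ (⟨ c , x ⟩ ≡ ⟨ c , y ⟩ × x ≤[ cs ] y)

_≡[_]_ : ∀ {n} → Pt n → List (Pt n) → Pt n → Set
x ≡[ cs ] y = All (λ c → ⟨ c , x ⟩ ≡ ⟨ c , y ⟩) cs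

Separating : ∀ {n} → List (Pt n) → Set
Separating cs = ∀ {x y} → x ≡[ cs ] y → x ≈ y

module _ {n : ℕ} where

  ≈⇒≡[] : ∀ cs {x y : Pt n} → x ≈ y → x ≡[ cs ] y
  ≈⇒≡[] cs x≈y = All.tabulate (λ {c} _ → ⟨⟩-congʳ c x≈y)

  ≡[]-sym : ∀ {cs} {x y : Pt n} → x ≡[ cs ] y → y ≡[ cs ] x
  ≡[]-sym = All.map sym

  ≡[]-trans : ∀ {cs} {x y z : Pt n} → x ≡[ cs ] y → y ≡[ cs ] z → x ≡[ cs ] z
  ≡[]-trans x≡y y≡z = All.zipWith (λ (p , q) → trans p q) (x≡y , y≡z)

  lex-head : ∀ {c cs} {x y : Pt n} → x ≤[ c ∷ cs ] y → ⟨ c , x ⟩ ≤ ⟨ c , y ⟩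
  lex-head (inj₁ cx<cy)      = ℚ.<⇒≤ cx<cy
  lex-head (inj₂ (cx≡cy , _)) = ℚ.≤-reflexive cx≡cy

  lex-resp : ∀ cs {x x' y y' : Pt n} → x ≡[ cs ] x' → y ≡[ cs ] y' → x ≤[ cs ] y → x' ≤[ cs ] y'
  lex-resp []       _           _           _ = tt
  lex-resp (c ∷ cs) (ex ∷ _)    (ey ∷ _)    (inj₁ cx<cy) = inj₁ (subst₂ _<_ ex ey cx<cy)
  lex-resp (c ∷ cs) (ex ∷ exs)  (ey ∷ eys)  (inj₂ (cx≡cy , x≤y)) =
    inj₂ (trans (sym ex) (trans cx≡cy ey) , lex-resp cs exs eys x≤y)

  lex-antisym : ∀ cs {x y : Pt n} → x ≤[ cs ] y → y ≤[ cs ] x → x ≡[ cs ] y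
  lex-antisym []       _                    _            = []
  lex-antisym (c ∷ cs) (inj₁ cx<cy)         y≤x          =
    ⊥-elim (ℚ.<-irrefl refl (ℚ.<-≤-trans cx<cy (lex-head {c} y≤x)))
  lex-antisym (c ∷ cs) (inj₂ (cx≡cy , _))   (inj₁ cy<cx) = ⊥-elim (ℚ.<-irrefl (sym cx≡cy) cy<cx)
  lex-antisym (c ∷ cs) (inj₂ (cx≡cy , x≤y)) (inj₂ (_ , y≤x)) =
    cx≡cy ∷ lex-antisym cs x≤y y≤x

  lex-++⁻ˡ : ∀ cs ds {x y : Pt n} → x ≤[ cs ++ ds ] y → x ≤[ cs ] y
  lex-++⁻ˡ []       ds _                    = tt
  lex-++⁻ˡ (c ∷ cs) ds (inj₁ cx<cy)         = inj₁ cx<cy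
  lex-++⁻ˡ (c ∷ cs) ds (inj₂ (cx≡cy , x≤y)) = inj₂ (cx≡cy , lex-++⁻ˡ cs ds x≤y)

  lex-++⁻ʳ : ∀ cs ds {x y : Pt n} → x ≡[ cs ] y → x ≤[ cs ++ ds ] y → x ≤[ ds ] y
  lex-++⁻ʳ []       ds _             x≤y               = x≤y
  lex-++⁻ʳ (c ∷ cs) ds (cx≡cy ∷ _)   (inj₁ cx<cy)      = ⊥-elim (ℚ.<-irrefl cx≡cy cx<cy)
  lex-++⁻ʳ (c ∷ cs) ds (_ ∷ x≡y)     (inj₂ (_ , x≤y))  = lex-++⁻ʳ cs ds x≡y x≤y

  lex-negate : ∀ cs {x y : Pt n} → x ≤[ map negate cs ] y → y ≤[ cs ] x
  lex-negate []       _ = tt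
  lex-negate (c ∷ cs) {x} {y} (inj₁ -cx<-cy) =
    inj₁ (subst₂ _<_ (neg-involutive _) (neg-involutive _)
            (ℚ.neg-antimono-< (subst₂ _<_ (⟨negate⟩ c x) (⟨negate⟩ c y) -cx<-cy)))
  lex-negate (c ∷ cs) {x} {y} (inj₂ (-cx≡-cy , x≤y)) =
    inj₂ (sym (⟨negate⟩-injective c -cx≡-cy) , lex-negate cs x≤y)

  lex-translate : ∀ cs a {x y : Pt n} → x ≤[ cs ] y → a ⊕ x ≤[ cs ] a ⊕ y
  lex-translate []       a _ = tt
  lex-translate (c ∷ cs) a {x} {y} (inj₁ cx<cy) =
    inj₁ (subst₂ _<_ (sym (⟨⟩-distrib-⊕ c a x)) (sym (⟨⟩-distrib-⊕ c a y)) (ℚ.+-monoʳ-< ⟨ c , a ⟩ cx<cy))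
  lex-translate (c ∷ cs) a {x} {y} (inj₂ (cx≡cy , x≤y)) =
    inj₂ (trans (⟨⟩-distrib-⊕ c a x) (trans (cong (⟨ c , a ⟩ +_) cx≡cy) (sym (⟨⟩-distrib-⊕ c a y))) ,
          lex-translate cs a x≤y)

  lex-convex : ∀ cs {t} {x y v : Pt n} → 0ℚ < t → t < 1ℚ → v ≈ ((t · x) ⊕ ((1ℚ - t) · y)) →
               x ≤[ cs ] v → y ≤[ cs ] v → x ≡[ cs ] v × y ≡[ cs ] v
  lex-convex []       _   _   _   _   _   = [] , []
  lex-convex (c ∷ cs) {t} {x} {y} {v} t>0 t<1 v≈xy x≤v y≤v =
    let cx≡cv , cy≡cv = convex-≡⇒≡ t>0 t<1 (lex-head {c} x≤v) (lex-head {c} y≤v) (sym cv≡cxy)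
        x≡v , y≡v     = lex-convex cs t>0 t<1 v≈xy (lex-++⁻ʳ (c ∷ []) cs (cx≡cv ∷ []) x≤v)
                                                   (lex-++⁻ʳ (c ∷ []) cs (cy≡cv ∷ []) y≤v)
    in  cx≡cv ∷ x≡v , cy≡cv ∷ y≡v
    where
    cv≡cxy : ⟨ c , v ⟩ ≡ t * ⟨ c , x ⟩ + (1ℚ - t) * ⟨ c , y ⟩
    cv≡cxy = trans (⟨⟩-congʳ c v≈xy)
               (trans (⟨⟩-distrib-⊕ c (t · x) _) (cong₂ _+_ (⟨⟩-· c t x) (⟨⟩-· c (1ℚ - t) y)))

++-separating : ∀ {n} (cs ds : List (Pt n)) → Separating ds → Separating (cs ++ ds)
++-separating cs ds sep x≡y = sep (++⁻ʳ cs x≡y)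

coordinates : ∀ {n} → List (Pt n)
coordinates = tabulate basis

coordinates-separating : ∀ {n} → Separating (coordinates {n})
coordinates-separating {x = x} {y} x≡y i =
  trans (sym (sumFin-basis i x)) (trans (tabulate⁻ x≡y i) (sumFin-basis i y))

negated-coordinates-separating : ∀ {n} → Separating (map negate (coordinates {n}))
negated-coordinates-separating x≡y =
  coordinates-separating (All.map (λ {c} → ⟨negate⟩-injective c) (map⁻ x≡y))

LexMax : ∀ {n} → List (Pt n) → PtSet n → Pt n → Set
LexMax cs S v = S v × (∀ x → S x → x ≤[ cs ] v)

lexMax⇒vertex : ∀ {n} {cs : List (Pt n)} {S v} → Separating cs → LexMax cs S v → IsVertex S v
lexMax⇒vertex {cs = cs} separating (v∈S , maximal) = v∈S , λ x y t x∈S y∈S t>0 t<1 v≈xy →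
  let x≡v , y≡v = lex-convex cs t>0 t<1 v≈xy (maximal x x∈S) (maximal y y∈S)
  in  separating (≡[]-trans x≡v (≡[]-sym y≡v))

argmax∈ : ∀ {A : Set} (f : A → ℚ) ⊥ xs → argmax f ⊥ xs ∈ ⊥ ∷ xs
argmax∈ f ⊥ xs with argmax-sel f ⊥ xs
... | inj₁ argmax≡⊥ = here argmax≡⊥
... | inj₂ argmax∈xs = there argmax∈xs

argmax-maximal : ∀ {A : Set} (f : A → ℚ) ⊥ xs {x} → x ∈ ⊥ ∷ xs → f x ≤ f (argmax f ⊥ xs)
argmax-maximal f ⊥ xs (here refl) = f[⊥]≤f[argmax] {f = f} ⊥ xs
argmax-maximal f ⊥ xs (there x∈xs) = All.lookup (f[xs]≤f[argmax] {f = f} ⊥ xs) x∈xs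

module _ {n K : ℕ} (V : Fin K → Pt n) where

  Supported : (Fin K → ℚ) → List (Fin K) → Set
  Supported w S = ∀ j → 0ℚ < w j → j ∈ S

  -- A combination attaining the maximum b of ⟨ c , _ ⟩ over the generators in j ∷ S is supported
  -- on the maximisers T, among which the remaining cs are maximised recursively.
  lexMax-generator : ∀ cs j S → ∃[ i ] i ∈ j ∷ S ×
    (∀ w → (∀ l → 0ℚ ≤ w l) → sumFin w ≡ 1ℚ → Supported w (j ∷ S) → comb w V ≤[ cs ] V i)
  lexMax-generator []       j S = j , here refl , λ _ _ _ _ → tt
  lexMax-generator (c ∷ cs) j S = i , i∈j∷S , dominated
    where
    h : Fin K → ℚ
    h l = ⟨ c , V l ⟩
    b : Fin K
    b = argmax h j S
    maximiser? : Decidable (λ l → h l ≡ h b)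
    maximiser? l = h l ℚ.≟ h b
    T : List (Fin K)
    T = filter maximiser? (j ∷ S)
    i = proj₁ (lexMax-generator cs b T)
    i∈b∷T = proj₁ (proj₂ (lexMax-generator cs b T))
    i-dominates = proj₂ (proj₂ (lexMax-generator cs b T))
    i∈j∷S×hi≡hb : i ∈ j ∷ S × h i ≡ h b
    i∈j∷S×hi≡hb with i∈b∷T
    ... | here i≡b  = subst (_∈ j ∷ S) (sym i≡b) (argmax∈ h j S) , cong h i≡b
    ... | there i∈T = ∈-filter⁻ maximiser? i∈T
    i∈j∷S = proj₁ i∈j∷S×hi≡hb
    hi≡hb = proj₂ i∈j∷S×hi≡hb
    dominated : ∀ w → (∀ l → 0ℚ ≤ w l) → sumFin w ≡ 1ℚ → Supported w (j ∷ S) → comb w V ≤[ c ∷ cs ] V i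
    dominated w w≥0 ∑w≡1 supported with ⟨ c , comb w V ⟩ ℚ.<? h b
    ... | yes cx<hb = inj₁ (subst (_ <_) (sym hi≡hb) cx<hb)
    ... | no  cx≮hb = inj₂ (trans cx≡hb (sym hi≡hb) , i-dominates w w≥0 ∑w≡1 supported-on-T)
      where
      hl≤hb : ∀ l → 0ℚ < w l → h l ≤ h b
      hl≤hb l wl>0 = argmax-maximal h j S (supported l wl>0)
      cx≡hb : ⟨ c , comb w V ⟩ ≡ h b
      cx≡hb = ℚ.≤-antisym (subst (_≤ h b) (sym (⟨⟩-comb c w V)) (average-≤ w≥0 ∑w≡1 hl≤hb)) (ℚ.≮⇒≥ cx≮hb)
      supported-on-T : Supported w (b ∷ T)
      supported-on-T l wl>0 = there (∈-filter⁺ maximiser? (supported l wl>0)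
        (average-≡⇒≡ w≥0 ∑w≡1 hl≤hb (trans (sym (⟨⟩-comb c w V)) cx≡hb) l wl>0))

generator : ∀ {n} (P : IntPolytope n) → Fin (suc (IntPolytope.k P)) → Pt n
generator P j = embed (IntPolytope.verts P j)

generator∈ : ∀ {n} (P : IntPolytope n) j → ⟦ P ⟧ (generator P j)
generator∈ P j =
  basis j , basis-nonNeg j , sumFin[basis]≡1 j , λ i → sym (sumFin-basis j (λ l → generator P l i))

polytope-lexMax : ∀ {n} (P : IntPolytope n) cs → ∃[ v ] LexMax cs ⟦ P ⟧ v
polytope-lexMax P cs with lexMax-generator (generator P) cs zero (allFin _)
... | j , _ , dominated = generator P j , generator∈ P j , λ x (w , w≥0 , ∑w≡1 , x≈comb) →
  lex-resp cs (≈⇒≡[] cs (λ i → sym (x≈comb i))) (≈⇒≡[] cs (λ _ → refl))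
    (dominated w w≥0 ∑w≡1 (λ l _ → there (∈-allFin l)))

≡[]-⊕ʳ : ∀ {n} (cs : List (Pt n)) {a a'} b → a ≡[ cs ] a' → a ⊕ b ≡[ cs ] a' ⊕ b
≡[]-⊕ʳ cs {a} {a'} b = All.map (λ {c} ca≡ca' →
  trans (⟨⟩-distrib-⊕ c a b) (trans (cong (_+ ⟨ c , b ⟩) ca≡ca') (sym (⟨⟩-distrib-⊕ c a' b))))

lexMax-minkowski : ∀ {n} (cs : List (Pt n)) {S SA SB : PtSet n} {a b v} →
  SameSet S (Minkowski SA SB) → (∀ {a a'} → SA a → SA a' → a ≡[ cs ] a') →
  LexMax cs SB b → LexMax cs S v → SA a → a ⊕ b ≡[ cs ] v
lexMax-minkowski cs {S} {a = a} {b} {v} S≡A+B cs-const (b∈SB , b-max) (v∈S , v-max) a∈SA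
  with proj₁ (S≡A+B v) v∈S
... | a₁ , b₁ , a₁∈SA , b₁∈SB , v≈a₁+b₁ = lex-antisym cs (v-max (a ⊕ b) a+b∈S) v≤a+b
  where
  a+b∈S : S (a ⊕ b)
  a+b∈S = proj₂ (S≡A+B (a ⊕ b)) (a , b , a∈SA , b∈SB , λ _ → refl)
  v≤a+b : v ≤[ cs ] a ⊕ b
  v≤a+b = lex-resp cs (≡[]-sym (≈⇒≡[] cs v≈a₁+b₁))
                      (≡[]-⊕ʳ cs b (cs-const a₁∈SA a∈SA))
                      (lex-translate cs a₁ (b-max b₁ b₁∈SB))

rows : ∀ {m n} → LinMap m n → List (Pt n)
rows π = tabulate π

summand-collapses : ∀ {n m} (π : LinMap m n) (P B : IntPolytope n) {SA : PtSet n} →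
  InjectiveOnVertices π ⟦ P ⟧ → SameSet ⟦ P ⟧ (Minkowski SA ⟦ B ⟧) →
  (∀ {a a'} → SA a → SA a' → apply π a ≈ apply π a') → ∀ {a a'} → SA a → SA a' → a ≈ a'
summand-collapses π P B {SA} injective P≡A+B π-const {a} {a'} a∈SA a'∈SA i =
  +-cancelʳ (b i) (a i) (a' i) (trans (on-top a∈SA i) (sym (on-top a'∈SA i)))
  where
  B-max = polytope-lexMax B (rows π)
  P-max₊ = polytope-lexMax P (rows π ++ coordinates)
  P-max₋ = polytope-lexMax P (rows π ++ map negate coordinates)
  b = proj₁ B-max
  v₊ = proj₁ P-max₊
  v₋ = proj₁ P-max₋
  v₊-max = proj₂ P-max₊
  v₋-max = proj₂ P-max₋

  on-face : ∀ ds {v} → LexMax (rows π ++ ds) ⟦ P ⟧ v → ∀ {x} → SA x → x ⊕ b ≡[ rows π ] v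
  on-face ds (v∈P , v-max) =
    lexMax-minkowski (rows π) P≡A+B (λ x∈SA y∈SA → tabulate⁺ (π-const x∈SA y∈SA)) (proj₂ B-max)
      (v∈P , λ x x∈P → lex-++⁻ˡ (rows π) ds (v-max x x∈P))

  v₊≈v₋ : v₊ ≈ v₋
  v₊≈v₋ = injective v₊ v₋
    (lexMax⇒vertex (++-separating (rows π) _ coordinates-separating) v₊-max)
    (lexMax⇒vertex (++-separating (rows π) _ negated-coordinates-separating) v₋-max)
    (tabulate⁻ (≡[]-trans (≡[]-sym (on-face _ v₊-max a∈SA)) (on-face _ v₋-max a∈SA)))

  on-top : ∀ {x} → SA x → (x ⊕ b) ≈ v₊
  on-top {x} x∈SA = coordinates-separating (lex-antisym coordinates x+b≤v₊ v₊≤x+b)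
    where
    x+b∈P : ⟦ P ⟧ (x ⊕ b)
    x+b∈P = proj₂ (P≡A+B (x ⊕ b)) (x , b , x∈SA , proj₁ (proj₂ B-max) , λ _ → refl)
    x+b≤v₊ : x ⊕ b ≤[ coordinates ] v₊
    x+b≤v₊ = lex-++⁻ʳ (rows π) _ (on-face _ v₊-max x∈SA) (proj₂ v₊-max (x ⊕ b) x+b∈P)
    v₊≤x+b : v₊ ≤[ coordinates ] x ⊕ b
    v₊≤x+b = lex-resp coordinates (≈⇒≡[] _ (λ j → sym (v₊≈v₋ j))) (≈⇒≡[] _ (λ _ → refl))
      (lex-negate coordinates (lex-++⁻ʳ (rows π) _ (on-face _ v₋-max x∈SA) (proj₂ v₋-max (x ⊕ b) x+b∈P)))

module _ {n : ℕ} where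

  SameSet-trans : {S T U : PtSet n} → SameSet S T → SameSet T U → SameSet S U
  SameSet-trans S≡T T≡U x = (λ x∈S → proj₁ (T≡U x) (proj₁ (S≡T x) x∈S)) ,
                            (λ x∈U → proj₂ (S≡T x) (proj₂ (T≡U x) x∈U))

  minkowski-comm : {S T : PtSet n} → SameSet (Minkowski S T) (Minkowski T S)
  minkowski-comm x = swap , swap
    where
    swap : ∀ {S T : PtSet n} → Minkowski S T x → Minkowski T S x
    swap (a , b , a∈S , b∈T , x≈a+b) = b , a , b∈T , a∈S , λ i → trans (x≈a+b i) (ℚ.+-comm (a i) (b i))

  minkowski-cong : {S S' T T' : PtSet n} → SameSet S S' → SameSet T T' →
                   SameSet (Minkowski S T) (Minkowski S' T')
  minkowski-cong S≡S' T≡T' x =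
    (λ (a , b , a∈S , b∈T , x≈a+b) → a , b , proj₁ (S≡S' a) a∈S , proj₁ (T≡T' b) b∈T , x≈a+b) ,
    (λ (a , b , a∈S' , b∈T' , x≈a+b) → a , b , proj₂ (S≡S' a) a∈S' , proj₂ (T≡T' b) b∈T' , x≈a+b)

  _≈?_ : (x y : Pt n) → Dec (x ≈ y)
  x ≈? y = all? (λ i → x i ℚ.≟ y i)

module _ {n m : ℕ} (π : LinMap m n) where

  image-cong : {S T : PtSet n} → SameSet S T → SameSet (image π S) (image π T)
  image-cong S≡T y = (λ (x , x∈S , y≈πx) → x , proj₁ (S≡T x) x∈S , y≈πx) ,
                     (λ (x , x∈T , y≈πx) → x , proj₂ (S≡T x) x∈T , y≈πx)

  image-minkowski : {S T : PtSet n} →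
                    SameSet (image π (Minkowski S T)) (Minkowski (image π S) (image π T))
  image-minkowski y =
    (λ (x , (a , b , a∈S , b∈T , x≈a+b) , y≈πx) →
       apply π a , apply π b , (a , a∈S , λ _ → refl) , (b , b∈T , λ _ → refl) ,
       λ r → trans (y≈πx r) (trans (⟨⟩-congʳ (π r) x≈a+b) (⟨⟩-distrib-⊕ (π r) a b))) ,
    (λ (_ , _ , (a , a∈S , a'≈πa) , (b , b∈T , b'≈πb) , y≈a'+b') →
       a ⊕ b , (a , b , a∈S , b∈T , λ _ → refl) ,
       λ r → trans (y≈a'+b' r) (trans (cong₂ _+_ (a'≈πa r) (b'≈πb r)) (sym (⟨⟩-distrib-⊕ (π r) a b))))

  imagePolytope : IsIntegral π → IntPolytope n → IntPolytope m
  imagePolytope integral P =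
    intPolytope (IntPolytope.k P) (λ j → proj₁ (integral (IntPolytope.verts P j)))

  module _ (integral : IsIntegral π) (P : IntPolytope n) where

    apply-comb-generator : ∀ w →
      apply π (comb w (generator P)) ≈ comb w (generator (imagePolytope integral P))
    apply-comb-generator w r = trans (⟨⟩-comb (π r) w (generator P))
      (sumFin-cong (λ j → cong (w j *_) (proj₂ (integral (IntPolytope.verts P j)) r)))

    image-polytope : SameSet (image π ⟦ P ⟧) ⟦ imagePolytope integral P ⟧
    image-polytope y =
      (λ (x , (w , w≥0 , ∑w≡1 , x≈comb) , y≈πx) → w , w≥0 , ∑w≡1 ,
         λ r → trans (y≈πx r) (trans (⟨⟩-congʳ (π r) x≈comb) (apply-comb-generator w r))) ,
      (λ (w , w≥0 , ∑w≡1 , y≈comb) → comb w (generator P) , (w , w≥0 , ∑w≡1 , λ _ → refl) ,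
         λ r → trans (y≈comb r) (sym (apply-comb-generator w r)))

  apply-constant-on-polytope : ∀ (P : IntPolytope n) {y} → (∀ j → apply π (generator P j) ≈ y) →
                               ∀ {x} → ⟦ P ⟧ x → apply π x ≈ y
  apply-constant-on-polytope P {y} πV≈y {x} (w , w≥0 , ∑w≡1 , x≈comb) r = begin
    apply π x r                                    ≡⟨ ⟨⟩-congʳ (π r) x≈comb ⟩
    ⟨ π r , comb w (generator P) ⟩                 ≡⟨ ⟨⟩-comb (π r) w (generator P) ⟩
    sumFin (λ j → w j * apply π (generator P j) r) ≡⟨ sumFin-cong (λ j → cong (w j *_) (πV≈y j r)) ⟩
    sumFin (λ j → w j * y r)                       ≡⟨ average-const w≥0 ∑w≡1 (y r) ⟩
    y r                                            ∎
    where open ≡-Reasoning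

image-moreThanOnePoint : ∀ {n m} (π : LinMap m n) (integral : IsIntegral π) (P A B : IntPolytope n) →
  InjectiveOnVertices π ⟦ P ⟧ → SameSet ⟦ P ⟧ (Minkowski ⟦ A ⟧ ⟦ B ⟧) →
  MoreThanOnePoint ⟦ A ⟧ → MoreThanOnePoint ⟦ imagePolytope π integral A ⟧
image-moreThanOnePoint π integral P A B injective P≡A+B (a , a' , a∈A , a'∈A , a≉a')
  with all? (λ j → apply π (generator A j) ≈? apply π (generator A zero))
... | yes πV≈πV₀ = ⊥-elim (a≉a' (summand-collapses π P B injective P≡A+B π-constant a∈A a'∈A))
  where
  π-constant : ∀ {x x'} → ⟦ A ⟧ x → ⟦ A ⟧ x' → apply π x ≈ apply π x'
  π-constant x∈A x'∈A r = trans (apply-constant-on-polytope π A πV≈πV₀ x∈A r)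
                                (sym (apply-constant-on-polytope π A πV≈πV₀ x'∈A r))
... | no πV≉πV₀ with ¬∀⟶∃¬ _ _ (λ j → apply π (generator A j) ≈? apply π (generator A zero)) πV≉πV₀
...   | j , πVj≉πV₀ =
  apply π (generator A j) , apply π (generator A zero) , image∈ j , image∈ zero , πVj≉πV₀
  where
  image∈ : ∀ j → ⟦ imagePolytope π integral A ⟧ (apply π (generator A j))
  image∈ j = proj₁ (image-polytope π integral A _) (generator A j , generator∈ A j , λ _ → refl)

corollary8 : (n m : ℕ) (P : IntPolytope n) (π : LinMap m n) →
    IsIntegral π → InjectiveOnVertices π ⟦ P ⟧ →
    IntIndecomposable (image π ⟦ P ⟧) → IntIndecomposable ⟦ P ⟧
corollary8 n m P π integral injective πP-indecomposable (A , B , A-nontrivial , B-nontrivial , P≡A+B) =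
  πP-indecomposable (imagePolytope π integral A , imagePolytope π integral B ,
    image-moreThanOnePoint π integral P A B injective P≡A+B A-nontrivial ,
    image-moreThanOnePoint π integral P B A injective (SameSet-trans P≡A+B minkowski-comm) B-nontrivial ,
    SameSet-trans (image-cong π P≡A+B) (SameSet-trans (image-minkowski π)
      (minkowski-cong (image-polytope π integral A) (image-polytope π integral B))))
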